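{- Let $G$ be a finite simple graph and $l$ a positive integer. Then for every $p\in[0,1]$, \[ \operatorname{N}(G[K_l];p) = \operatorname{N}\big(G;\,1-(1-p)^l\big). \]
   Context: For a finite simple graph $G$, the node reliability $\operatorname{N}(G;p)$ is the probability that, when each vertex of $G$ is independently operational with probability $p\in[0,1]$ (edges being perfectly reliable), the set of operational vertices is nonempty and induces a connected subgraph of $G$; it is a polynomial in $p$. For a graph $G$ and positive integer $l$, $G[K_l]$ denotes the lexicographic product of $G$ with $K_l$: the graph obtained from $G$ by replacing each vertex $v$ by a complete graph $K_l^v$ on $l$ vertices, where two vertices in $K_l^u$ and $K_l^v$ with $u\neq v$ are adjacent iff $uv$ is an edge of $G$, and all vertices within the same $K_l^v$ are adjacent.
   Formalization: The probability p ranges over the rationals in [0,1]. -}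

module Defs where

open import Data.Bool using (Bool; true; false; _∧_; _∨_; not; if_then_else_)
open import Data.Nat using (ℕ; zero; suc) renaming (_*_ to _*ℕ_)
open import Data.Fin using (Fin; zero; suc; remQuot)
open import Data.Fin.Properties using (_≟_)
open import Data.Product using (_×_; _,_; proj₁; proj₂)
open import Data.Vec using (Vec; []; _∷_; lookup)
open import Data.List using (List; []; _∷_; map; _++_; foldr)
open import Data.Rational using (ℚ; 0ℚ; 1ℚ; _+_; _*_; _-_)
open import Relation.Binary.PropositionalEquality using (_≡_)
open import Relation.Nullary.Decidable using (⌊_⌋)

record SimpleGraph (n : ℕ) : Set where
  field
    adj    : Fin n → Fin n → Bool
    sym    : ∀ u v → adj u v ≡ adj v u
    irrefl : ∀ u → adj u u ≡ false
open SimpleGraph public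

-- A bare adjacency relation on Fin n (used for node reliability, which
-- only depends on adjacency).
Adjacency : ℕ → Set
Adjacency n = Fin n → Fin n → Bool

-- Lexicographic product G[K_l]: vertex set Fin (n * l), where vertex i
-- corresponds to the pair (u , a) = remQuot l i with u ∈ V(G), a ∈ Fin l.
-- (u , a) ~ (v , b)  iff  (u = v and a ≠ b)  or  uv ∈ E(G).

lexK : ∀ {n} → SimpleGraph n → (l : ℕ) → Adjacency (n *ℕ l)
lexK {n} G l i j =
  let ua = remQuot {n} l i
      vb = remQuot {n} l j
  in (⌊ proj₁ ua ≟ proj₁ vb ⌋ ∧ not ⌊ proj₂ ua ≟ proj₂ vb ⌋)
     ∨ adj G (proj₁ ua) (proj₁ vb)

VSet : ℕ → Set
VSet n = Vec Bool n

allSets : (n : ℕ) → List (VSet n)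
allSets zero    = [] ∷ []
allSets (suc n) = map (true ∷_) (allSets n) ++ map (false ∷_) (allSets n)

anyFin : ∀ {n} → (Fin n → Bool) → Bool
anyFin {zero}  f = false
anyFin {suc n} f = f zero ∨ anyFin (λ i → f (suc i))

allFin : ∀ {n} → (Fin n → Bool) → Bool
allFin {zero}  f = true
allFin {suc n} f = f zero ∧ allFin (λ i → f (suc i))

walkIn : ∀ {n} → Adjacency n → VSet n → ℕ → Fin n → Fin n → Bool
walkIn A S zero    u v = ⌊ u ≟ v ⌋ ∧ lookup S u
walkIn A S (suc k) u v =
  walkIn A S k u v ∨ anyFin (λ w → walkIn A S k u w ∧ A w v ∧ lookup S v)

-- S induces a connected subgraph: any two vertices of S are joined by a
-- walk inside S (a walk of length ≤ n suffices, since any walk contains a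
-- path, and paths in an n-vertex graph have length < n).
connectedIn : ∀ {n} → Adjacency n → VSet n → Bool
connectedIn {n} A S =
  allFin (λ u → allFin (λ v → not (lookup S u ∧ lookup S v) ∨ walkIn A S n u v))

nonempty : ∀ {n} → VSet n → Bool
nonempty {n} S = anyFin (lookup S)

-- Node reliability:  N(G;p) = Σ_{S nonempty, G[S] connected} p^|S| (1-p)^(n-|S|)
-- (the probability that the set of operational vertices is exactly S,
-- summed over all good S).

weight : ∀ {n} → ℚ → VSet n → ℚ
weight p []          = 1ℚ
weight p (true  ∷ S) = p * weight p S
weight p (false ∷ S) = (1ℚ - p) * weight p S

sumℚ : List ℚ → ℚ
sumℚ = foldr _+_ 0ℚ

nodeRel : ∀ {n} → Adjacency n → ℚ → ℚ
nodeRel {n} A p =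
  sumℚ (map (λ S → if nonempty S ∧ connectedIn A S then weight p S else 0ℚ)
            (allSets n))

_^ℚ_ : ℚ → ℕ → ℚ
x ^ℚ zero  = 1ℚ
x ^ℚ suc k = x * (x ^ℚ k)

-- A set X of vertices of G[K_l] is connected and nonempty exactly when its shadow
-- {u | X meets K_l^u} is connected and nonempty in G: walks in G[K_l] project to
-- walks in G, and walks in G lift because the fibres are cliques and adjacent
-- fibres are completely joined. The node reliability of G[K_l] is thus the
-- expectation of a function of the shadow, and under the product measure with
-- parameter p the shadow is itself a product measure, with parameter
-- 1 - (1 - p)^l, the probability that a block of l vertices is not all down.
module Submission where

open import Data.Bool using (Bool; true; false; T; _∧_; _∨_; not; if_then_else_)
open import Data.Bool.Properties using (T-∧; T-∨; T-≡)
open import Data.Empty using (⊥-elim)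
open import Data.Fin using (Fin; zero; suc; combine; quotient; remainder)
open import Data.Fin.Properties using (_≟_; remQuot-combine; combine-remQuot)
open import Data.Fin.Subset using (Subset; _∈_; _⊆_; _⊂_; ∣_∣)
open import Data.Fin.Subset.Properties using (_∈?_; _⊂?_; ⊆-antisym; p⊂q⇒∣p∣<∣q∣; ∣p∣≤n)
open import Data.List using ([]; _∷_; map) renaming (_++_ to _++ᴸ_)
open import Data.List.Properties using (map-++; map-∘)
open import Data.Nat using (ℕ; zero; suc; _∸_; _≥_; z≤n; s≤s)
  renaming (_+_ to _+ℕ_; _*_ to _*ℕ_; _≤_ to _≤ℕ_; _<_ to _<ℕ_)
open import Data.Nat.Properties
  using (≤-refl; ≤-trans; ≤⇒≯; ≤-<-trans; m<n⇒m<1+n; m∸n+n≡m; m≤m+n)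
open import Data.Product using (∃; _×_; _,_; proj₁; proj₂)
open import Data.Rational using (ℚ; 0ℚ; 1ℚ; _≤_; _+_; _*_; _-_)
open import Data.Rational.Properties
  using (+-identityˡ; +-identityʳ; +-assoc; *-assoc; *-distribˡ-+; *-identityˡ; *-identityʳ; *-zeroʳ)
open import Data.Rational.Solver using (module +-*-Solver)
open import Data.Sum using (_⊎_; inj₁; inj₂)
open import Data.Vec using ([]; _∷_; lookup; tabulate; _++_)
open import Data.Vec.Properties
  using (lookup-++ˡ; lookup-++ʳ; lookup∘tabulate; tabulate-cong; []=⇒lookup; lookup⇒[]=)
open import Function using (_∘_)
open import Function.Bundles using (_⇔_; mk⇔; module Equivalence)
open import Relation.Binary.PropositionalEquality
open import Relation.Nullary using (yes; no)
open import Relation.Nullary.Decidable using (⌊_⌋; toWitness; fromWitness; fromWitnessFalse)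
open import Defs hiding (sym)

open Equivalence using (to; from)
open +-*-Solver

T-⇔⇒≡ : ∀ {x y} → (T x ⇔ T y) → x ≡ y
T-⇔⇒≡ {true}  {true}  _ = refl
T-⇔⇒≡ {true}  {false} e = ⊥-elim (to e _)
T-⇔⇒≡ {false} {true}  e = ⊥-elim (from e _)
T-⇔⇒≡ {false} {false} _ = refl

T-implies : ∀ {a b c} → T (not (a ∧ b) ∨ c) ⇔ (T a → T b → T c)
T-implies {true}  {true}  = mk⇔ (λ c _ _ → c) (λ f → f _ _)
T-implies {true}  {false} = mk⇔ (λ _ _ ()) _
T-implies {false}         = mk⇔ (λ _ ()) _

anyFin⁺ : ∀ {n} (f : Fin n → Bool) i → T (f i) → T (anyFin f)
anyFin⁺ f zero    t = from T-∨ (inj₁ t)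
anyFin⁺ f (suc i) t = from T-∨ (inj₂ (anyFin⁺ (f ∘ suc) i t))

anyFin⁻ : ∀ {n} (f : Fin n → Bool) → T (anyFin f) → ∃ λ i → T (f i)
anyFin⁻ {suc n} f t with to T-∨ t
... | inj₁ t₀ = zero , t₀
... | inj₂ t₁ with anyFin⁻ (f ∘ suc) t₁
...   | i , tᵢ = suc i , tᵢ

anyFin-cong : ∀ {n} {f g : Fin n → Bool} → (∀ i → f i ≡ g i) → anyFin f ≡ anyFin g
anyFin-cong {zero}  e = refl
anyFin-cong {suc n} e = cong₂ _∨_ (e zero) (anyFin-cong (e ∘ suc))

T-allFin : ∀ {n} {f : Fin n → Bool} → T (allFin f) ⇔ (∀ i → T (f i))
T-allFin {zero}  = mk⇔ (λ _ ()) _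
T-allFin {suc n} = mk⇔
  (λ t → λ { zero → proj₁ (to T-∧ t) ; (suc i) → to T-allFin (proj₂ (to T-∧ t)) i })
  (λ t → from T-∧ (t zero , from T-allFin (t ∘ suc)))

∈-tabulate⁺ : ∀ {n} {f : Fin n → Bool} {i} → T (f i) → i ∈ tabulate f
∈-tabulate⁺ {f = f} {i} t = lookup⇒[]= i _ (trans (lookup∘tabulate f i) (to T-≡ t))

∈-tabulate⁻ : ∀ {n} {f : Fin n → Bool} {i} → i ∈ tabulate f → T (f i)
∈-tabulate⁻ {f = f} {i} i∈ = from T-≡ (trans (sym (lookup∘tabulate f i)) ([]=⇒lookup i∈))

⊆⇒≡⊎⊂ : ∀ {N} {p q : Subset N} → p ⊆ q → p ≡ q ⊎ p ⊂ q
⊆⇒≡⊎⊂ {p = p} {q} p⊆q with p ⊂? q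
... | yes p⊂q = inj₂ p⊂q
... | no p⊄q = inj₁ (⊆-antisym p⊆q q⊆p)
  where
  q⊆p : q ⊆ p
  q⊆p {x} x∈q with x ∈? p
  ... | yes x∈p = x∈p
  ... | no x∉p = ⊥-elim (p⊄q (p⊆q , x , x∈q , x∉p))

-- A chain whose next term is determined by the current one stops growing
-- after at most N strict steps. Applied to the sets reachable within k steps,
-- it brings walks down to the length bound N used by connectedIn.
module IncreasingChain {N : ℕ} (R : ℕ → Subset N)
         (R-mono : ∀ k → R k ⊆ R (suc k))
         (R-next : ∀ j k → R j ≡ R k → R (suc j) ≡ R (suc k)) where

  ⊆-+ : ∀ m k → R k ⊆ R (m +ℕ k)
  ⊆-+ zero    k x∈ = x∈
  ⊆-+ (suc m) k x∈ = R-mono (m +ℕ k) (⊆-+ m k x∈)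

  constant-after : ∀ {j} → R j ≡ R (suc j) → ∀ {k} → j ≤ℕ k → R k ≡ R j
  constant-after {j} e {k} j≤k = subst (λ m → R m ≡ R j) (m∸n+n≡m j≤k) (go (k ∸ j))
    where
    go : ∀ m → R (m +ℕ j) ≡ R j
    go zero    = refl
    go (suc m) = trans (R-next (m +ℕ j) j (go m)) (sym e)

  stalls-or-grows : ∀ k → (∃ λ j → j <ℕ k × R j ≡ R (suc j)) ⊎ k ≤ℕ ∣ R k ∣
  stalls-or-grows zero = inj₂ z≤n
  stalls-or-grows (suc k) with stalls-or-grows k | ⊆⇒≡⊎⊂ (R-mono k)
  ... | inj₁ (j , j<k , e) | _        = inj₁ (j , m<n⇒m<1+n j<k , e)
  ... | inj₂ _             | inj₁ e   = inj₁ (k , ≤-refl , e)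
  ... | inj₂ k≤∣R∣         | inj₂ R⊂R = inj₂ (≤-<-trans k≤∣R∣ (p⊂q⇒∣p∣<∣q∣ R⊂R))

  stalls : ∃ λ j → j ≤ℕ N × R j ≡ R (suc j)
  stalls with stalls-or-grows (suc N)
  ... | inj₁ (j , s≤s j≤N , e) = j , j≤N , e
  ... | inj₂ N<∣R∣ = ⊥-elim (≤⇒≯ (∣p∣≤n (R (suc N))) N<∣R∣)

  ⊆-Nth : ∀ k → R k ⊆ R N
  ⊆-Nth k {x} x∈ with stalls
  ... | j , j≤N , e =
    subst (x ∈_) (trans (constant-after e (≤-trans j≤N (m≤m+n N k))) (sym (constant-after e j≤N)))
          (⊆-+ N k x∈)

module Walk {N : ℕ} (A : Adjacency N) (S : VSet N) where

  private variable
    k : ℕ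
    u v w : Fin N

  walkIn-refl : T (lookup S u) → T (walkIn A S 0 u u)
  walkIn-refl u∈S = from T-∧ (fromWitness refl , u∈S)

  walkIn-zero⁻ : ∀ u v → T (walkIn A S 0 u v) → u ≡ v × T (lookup S u)
  walkIn-zero⁻ _ _ t = let e , u∈S = to T-∧ t in toWitness e , u∈S

  walkIn-suc : ∀ k → T (walkIn A S k u v) → T (walkIn A S (suc k) u v)
  walkIn-suc _ t = from T-∨ (inj₁ t)

  walkIn-snoc : ∀ k → T (walkIn A S k u w) → T (A w v) → T (lookup S v) → T (walkIn A S (suc k) u v)
  walkIn-snoc {w = w} _ uw wv v∈S =
    from T-∨ (inj₂ (anyFin⁺ _ w (from T-∧ (uw , from T-∧ (wv , v∈S)))))

  walkIn-suc⁻ : ∀ k → T (walkIn A S (suc k) u v) →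
    T (walkIn A S k u v) ⊎ ∃ λ w → T (walkIn A S k u w) × T (A w v) × T (lookup S v)
  walkIn-suc⁻ _ t with to T-∨ t
  ... | inj₁ t′ = inj₁ t′
  ... | inj₂ t′ with anyFin⁻ _ t′
  ...   | w , t″ = let uw , wv∧v∈S = to T-∧ t″ in inj₂ (w , uw , to T-∧ wv∧v∈S)

  walkIn-target : ∀ k {u v} → T (walkIn A S k u v) → T (lookup S v)
  walkIn-target zero {u} {v} t with walkIn-zero⁻ u v t
  ... | refl , u∈S = u∈S
  walkIn-target (suc k) t with walkIn-suc⁻ k t
  ... | inj₁ t′ = walkIn-target k t′
  ... | inj₂ (_ , _ , _ , v∈S) = v∈S

  reach : ℕ → Fin N → Subset N
  reach k u = tabulate (walkIn A S k u)

  reach-next : ∀ u j k → reach j u ≡ reach k u → reach (suc j) u ≡ reach (suc k) u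
  reach-next u j k e = tabulate-cong λ v →
    cong₂ _∨_ (same v) (anyFin-cong λ w → cong (_∧ (A w v ∧ lookup S v)) (same w))
    where
    same : ∀ v → walkIn A S j u v ≡ walkIn A S k u v
    same v = trans (sym (lookup∘tabulate _ v)) (trans (cong (λ R → lookup R v) e) (lookup∘tabulate _ v))

  walkIn-≤N : ∀ k → T (walkIn A S k u v) → T (walkIn A S N u v)
  walkIn-≤N {u} k t = ∈-tabulate⁻ (⊆-Nth k (∈-tabulate⁺ t))
    where
    open IncreasingChain (λ j → reach j u) (λ j v∈ → ∈-tabulate⁺ (walkIn-suc j (∈-tabulate⁻ v∈)))
                         (reach-next u)

WalkConnected : ∀ {N} → Adjacency N → VSet N → Set
WalkConnected {N} A S = ∀ u v → T (lookup S u) → T (lookup S v) → T (walkIn A S N u v)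

T-connectedIn : ∀ {N} {A : Adjacency N} {S : VSet N} → T (connectedIn A S) ⇔ WalkConnected A S
T-connectedIn = mk⇔ (λ c u v → to T-implies (to T-allFin (to T-allFin c u) v))
                    (λ c → from T-allFin λ u → from T-allFin λ v → from T-implies (c u v))

module _ {M N : ℕ} (f : Fin M → Fin N) {A : Adjacency M} {B : Adjacency N}
         {S : VSet M} {S′ : VSet N} where
  private
    module A = Walk A S
    module B = Walk B S′

  walkIn-map : (∀ {i} → T (lookup S i) → T (lookup S′ (f i))) →
               (∀ {i j} → T (A i j) → f i ≡ f j ⊎ T (B (f i) (f j))) →
               ∀ k {i j} → T (walkIn A S k i j) → T (walkIn B S′ k (f i) (f j))
  walkIn-map f-mem f-adj zero {i} {j} t with A.walkIn-zero⁻ i j t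
  ... | refl , i∈S = B.walkIn-refl (f-mem i∈S)
  walkIn-map f-mem f-adj (suc k) {i} t with A.walkIn-suc⁻ k t
  ... | inj₁ t′ = B.walkIn-suc k (walkIn-map f-mem f-adj k t′)
  ... | inj₂ (w , t′ , a , j∈S) with f-adj a
  ...   | inj₁ fw≡fj =
    B.walkIn-suc k (subst (T ∘ walkIn B S′ k (f i)) fw≡fj (walkIn-map f-mem f-adj k t′))
  ...   | inj₂ b = B.walkIn-snoc k (walkIn-map f-mem f-adj k t′) b (f-mem j∈S)

  walkIn-lift : (∀ {u} → T (lookup S′ u) → ∃ λ i → f i ≡ u × T (lookup S i)) →
                (∀ {i j} → T (B (f i) (f j)) → T (A i j)) →
                (∀ {i j} → f i ≡ f j → i ≢ j → T (A i j)) →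
                ∀ k {i j} → T (lookup S i) → T (lookup S j) → T (walkIn B S′ k (f i) (f j)) →
                ∃ λ K → T (walkIn A S K i j)
  walkIn-lift f-onto between within zero {i} {j} i∈S j∈S t with B.walkIn-zero⁻ (f i) (f j) t | i ≟ j
  ... | _      , _ | yes refl = 0 , A.walkIn-refl i∈S
  ... | fi≡fj  , _ | no i≢j   = 1 , A.walkIn-snoc 0 (A.walkIn-refl i∈S) (within fi≡fj i≢j) j∈S
  walkIn-lift f-onto between within (suc k) i∈S j∈S t with B.walkIn-suc⁻ k t
  ... | inj₁ t′ = walkIn-lift f-onto between within k i∈S j∈S t′
  ... | inj₂ (w , t′ , b , _) with f-onto (B.walkIn-target k t′)
  ...   | c , refl , c∈S with walkIn-lift f-onto between within k i∈S c∈S t′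
  ...     | K , t″ = suc K , A.walkIn-snoc K t″ (between b) j∈S

-- The shadow of a vertex set of G[K_l] on G

shadow : ∀ {n} l → VSet (n *ℕ l) → VSet n
shadow {n} l X = tabulate λ u → anyFin λ a → lookup X (combine {n} u a)

shadow-++ : ∀ {n} l (x : VSet l) (y : VSet (n *ℕ l)) →
            shadow {suc n} l (x ++ y) ≡ nonempty x ∷ shadow {n} l y
shadow-++ l x y = cong₂ _∷_ (anyFin-cong (lookup-++ˡ x y))
                            (tabulate-cong λ u → anyFin-cong λ a → lookup-++ʳ x y (combine u a))

module _ {n : ℕ} (l : ℕ) (X : VSet (n *ℕ l)) where

  lookup-shadow : ∀ u → lookup (shadow {n} l X) u ≡ anyFin λ a → lookup X (combine {n} u a)
  lookup-shadow = lookup∘tabulate λ u → anyFin λ a → lookup X (combine {n} u a)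

  ∈shadow⁺ : ∀ i → T (lookup X i) → T (lookup (shadow {n} l X) (quotient {n} l i))
  ∈shadow⁺ i i∈X = subst T (sym (lookup-shadow (quotient {n} l i)))
    (anyFin⁺ (λ a → lookup X (combine (quotient {n} l i) a)) (remainder {n} l i)
             (subst (T ∘ lookup X) (sym (combine-remQuot {n} l i)) i∈X))

  ∈shadow⁻ : ∀ u → T (lookup (shadow {n} l X) u) → ∃ λ i → quotient {n} l i ≡ u × T (lookup X i)
  ∈shadow⁻ u u∈ with anyFin⁻ (λ a → lookup X (combine u a)) (subst T (lookup-shadow u) u∈)
  ... | a , t = combine u a , cong proj₁ (remQuot-combine {n} {l} u a) , t

  nonempty-shadow : nonempty (shadow {n} l X) ≡ nonempty X
  nonempty-shadow = T-⇔⇒≡ (mk⇔ down up)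
    where
    down : T (nonempty (shadow {n} l X)) → T (nonempty X)
    down t = let u , u∈ = anyFin⁻ (lookup (shadow {n} l X)) t
                 i , _ , i∈X = ∈shadow⁻ u u∈
             in anyFin⁺ (lookup X) i i∈X
    up : T (nonempty X) → T (nonempty (shadow {n} l X))
    up t = let i , i∈X = anyFin⁻ (lookup X) t
           in anyFin⁺ (lookup (shadow {n} l X)) (quotient {n} l i) (∈shadow⁺ i i∈X)

-- Connectedness in G[K_l]

isConnectedSet : ∀ {n} → Adjacency n → VSet n → Bool
isConnectedSet A S = nonempty S ∧ connectedIn A S

module _ {n : ℕ} (G : SimpleGraph n) (l : ℕ) where
  private
    q : Fin (n *ℕ l) → Fin n
    q = quotient {n} l

  lexK-adj⁻ : ∀ {i j} → T (lexK G l i j) → q i ≡ q j ⊎ T (adj G (q i) (q j))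
  lexK-adj⁻ {i} {j} t with to T-∨ t
  ... | inj₁ same-block = inj₁ (toWitness (proj₁ (to (T-∧ {⌊ q i ≟ q j ⌋}) same-block)))
  ... | inj₂ a = inj₂ a

  lexK-between : ∀ {i j} → T (adj G (q i) (q j)) → T (lexK G l i j)
  lexK-between a = from T-∨ (inj₂ a)

  lexK-within : ∀ {i j} → q i ≡ q j → i ≢ j → T (lexK G l i j)
  lexK-within {i} {j} qi≡qj i≢j =
    from T-∨ (inj₁ (from T-∧ (fromWitness {a? = q i ≟ q j} qi≡qj ,
                              fromWitnessFalse {a? = remainder {n} l i ≟ remainder {n} l j} ri≢rj)))
    where
    ri≢rj : remainder {n} l i ≢ remainder {n} l j
    ri≢rj ri≡rj = i≢j (begin
      i                                          ≡⟨ combine-remQuot {n} l i ⟨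
      combine (q i) (remainder {n} l i)          ≡⟨ cong₂ combine qi≡qj ri≡rj ⟩
      combine (q j) (remainder {n} l j)          ≡⟨ combine-remQuot {n} l j ⟩
      j                                          ∎)
      where open ≡-Reasoning

  connectedIn-lexK : ∀ X → connectedIn (lexK G l) X ≡ connectedIn (adj G) (shadow {n} l X)
  connectedIn-lexK X = T-⇔⇒≡ (mk⇔ (from T-connectedIn ∘ project ∘ to T-connectedIn)
                                  (from T-connectedIn ∘ lift ∘ to T-connectedIn))
    where
    project : WalkConnected (lexK G l) X → WalkConnected (adj G) (shadow l X)
    project c u v u∈ v∈ with ∈shadow⁻ {n} l X u u∈ | ∈shadow⁻ {n} l X v v∈
    ... | i , refl , i∈X | j , refl , j∈X =
      Walk.walkIn-≤N (adj G) (shadow {n} l X) (n *ℕ l)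
        (walkIn-map q (λ {i} → ∈shadow⁺ {n} l X i) lexK-adj⁻ (n *ℕ l) (c i j i∈X j∈X))
    lift : WalkConnected (adj G) (shadow l X) → WalkConnected (lexK G l) X
    lift c i j i∈X j∈X =
      let K , t = walkIn-lift q (λ {u} → ∈shadow⁻ {n} l X u) lexK-between lexK-within n i∈X j∈X
                    (c (q i) (q j) (∈shadow⁺ {n} l X i i∈X) (∈shadow⁺ {n} l X j j∈X))
      in Walk.walkIn-≤N (lexK G l) X K t

  isConnectedSet-lexK : ∀ X → isConnectedSet (lexK G l) X ≡ isConnectedSet (adj G) (shadow l X)
  isConnectedSet-lexK X = cong₂ _∧_ (sym (nonempty-shadow {n} l X)) (connectedIn-lexK X)

sumSets : ∀ {n} → (VSet n → ℚ) → ℚ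
sumSets {zero}  F = F []
sumSets {suc n} F = sumSets (F ∘ (true ∷_)) + sumSets (F ∘ (false ∷_))

sumℚ-++ : ∀ xs ys → sumℚ (xs ++ᴸ ys) ≡ sumℚ xs + sumℚ ys
sumℚ-++ []       ys = sym (+-identityˡ _)
sumℚ-++ (x ∷ xs) ys = trans (cong (x +_) (sumℚ-++ xs ys)) (sym (+-assoc x _ _))

sumℚ-allSets : ∀ {n} (F : VSet n → ℚ) → sumℚ (map F (allSets n)) ≡ sumSets F
sumℚ-allSets {zero}  F = +-identityʳ _
sumℚ-allSets {suc n} F = begin
  sumℚ (map F (map (true ∷_) Sₙ ++ᴸ map (false ∷_) Sₙ))
    ≡⟨ cong sumℚ (map-++ F (map (true ∷_) Sₙ) _) ⟩
  sumℚ (map F (map (true ∷_) Sₙ) ++ᴸ map F (map (false ∷_) Sₙ))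
    ≡⟨ sumℚ-++ (map F (map (true ∷_) Sₙ)) _ ⟩
  sumℚ (map F (map (true ∷_) Sₙ)) + sumℚ (map F (map (false ∷_) Sₙ))
    ≡⟨ cong₂ _+_ (cong sumℚ (map-∘ Sₙ)) (cong sumℚ (map-∘ Sₙ)) ⟨
  sumℚ (map (F ∘ (true ∷_)) Sₙ) + sumℚ (map (F ∘ (false ∷_)) Sₙ)
    ≡⟨ cong₂ _+_ (sumℚ-allSets (F ∘ (true ∷_))) (sumℚ-allSets (F ∘ (false ∷_))) ⟩
  sumSets F ∎
  where
  open ≡-Reasoning
  Sₙ = allSets n

sumSets-cong : ∀ {n} {F G : VSet n → ℚ} → (∀ x → F x ≡ G x) → sumSets F ≡ sumSets G
sumSets-cong {zero}  e = e []
sumSets-cong {suc n} e = cong₂ _+_ (sumSets-cong {n} (e ∘ (true ∷_))) (sumSets-cong {n} (e ∘ (false ∷_)))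

sumSets-*ˡ : ∀ {n} c (F : VSet n → ℚ) → sumSets (λ x → c * F x) ≡ c * sumSets F
sumSets-*ˡ {zero}  c F = refl
sumSets-*ˡ {suc n} c F =
  trans (cong₂ _+_ (sumSets-*ˡ {n} c _) (sumSets-*ˡ {n} c _)) (sym (*-distribˡ-+ c _ _))

sumSets-*-assoc : ∀ {n} c (F G : VSet n → ℚ) →
                  sumSets (λ x → (c * F x) * G x) ≡ c * sumSets (λ x → F x * G x)
sumSets-*-assoc {n} c F G = trans (sumSets-cong {n} λ x → *-assoc c (F x) (G x)) (sumSets-*ˡ {n} c _)

sumSets-++ : ∀ l {m} (F : VSet (l +ℕ m) → ℚ) →
             sumSets F ≡ sumSets {l} λ x → sumSets {m} λ y → F (x ++ y)
sumSets-++ zero    F = refl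
sumSets-++ (suc l) F = cong₂ _+_ (sumSets-++ l _) (sumSets-++ l _)

-- The product measure

weight-++ : ∀ {l m} p (x : VSet l) (y : VSet m) → weight p (x ++ y) ≡ weight p x * weight p y
weight-++ p []          y = sym (*-identityˡ _)
weight-++ p (true  ∷ x) y = trans (cong (p *_) (weight-++ p x y)) (sym (*-assoc p _ _))
weight-++ p (false ∷ x) y = trans (cong ((1ℚ - p) *_) (weight-++ p x y)) (sym (*-assoc (1ℚ - p) _ _))

sumSets-weight-nonempty : ∀ p k (φ : Bool → ℚ) →
  sumSets {k} (λ x → weight p x * φ (nonempty x)) ≡
  (1ℚ - (1ℚ - p) ^ℚ k) * φ true + (1ℚ - p) ^ℚ k * φ false
sumSets-weight-nonempty p zero φ =
  solve 2 (λ t f → con 1ℚ :* f := (con 1ℚ :- con 1ℚ) :* t :+ con 1ℚ :* f) refl (φ true) (φ false)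
sumSets-weight-nonempty p (suc k) φ = begin
  sumSets {k} (λ x → (p * weight p x) * φ true) +
  sumSets {k} (λ x → ((1ℚ - p) * weight p x) * φ (nonempty x))
    ≡⟨ cong₂ _+_ (sumSets-*-assoc {k} p (weight p) λ _ → φ true)
                 (sumSets-*-assoc {k} (1ℚ - p) (weight p) (φ ∘ nonempty)) ⟩
  p * sumSets {k} (λ x → weight p x * φ true) +
  (1ℚ - p) * sumSets {k} (λ x → weight p x * φ (nonempty x))
    ≡⟨ cong₂ (λ a b → p * a + (1ℚ - p) * b)
             (sumSets-weight-nonempty p k λ _ → φ true) (sumSets-weight-nonempty p k φ) ⟩
  p * ((1ℚ - r) * φ true + r * φ true) + (1ℚ - p) * ((1ℚ - r) * φ true + r * φ false)
    ≡⟨ solve 4 (λ p r t f →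
         p :* ((con 1ℚ :- r) :* t :+ r :* t) :+ (con 1ℚ :- p) :* ((con 1ℚ :- r) :* t :+ r :* f)
         := (con 1ℚ :- (con 1ℚ :- p) :* r) :* t :+ ((con 1ℚ :- p) :* r) :* f)
         refl p r (φ true) (φ false) ⟩
  (1ℚ - (1ℚ - p) ^ℚ suc k) * φ true + (1ℚ - p) ^ℚ suc k * φ false ∎
  where
  open ≡-Reasoning
  r = (1ℚ - p) ^ℚ k

module _ (l : ℕ) (p : ℚ) where
  private
    q = 1ℚ - (1ℚ - p) ^ℚ l

  sumSets-shadow : ∀ n (h : VSet n → ℚ) →
    sumSets {n *ℕ l} (λ X → weight p X * h (shadow l X)) ≡ sumSets {n} (λ Y → weight q Y * h Y)
  sumSets-shadow zero    h = refl
  sumSets-shadow (suc n) h = begin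
    sumSets {l +ℕ n *ℕ l} (λ X → weight p X * h (shadow l X))
      ≡⟨ sumSets-++ l _ ⟩
    sumSets {l} (λ x → sumSets {n *ℕ l} λ y → weight p (x ++ y) * h (shadow l (x ++ y)))
      ≡⟨ sumSets-cong {l} fibre ⟩
    sumSets {l} (λ x → weight p x * φ (nonempty x))
      ≡⟨ sumSets-weight-nonempty p l φ ⟩
    q * φ true + (1ℚ - p) ^ℚ l * φ false
      ≡⟨ cong (λ r → q * φ true + r * φ false)
              (solve 1 (λ r → r := con 1ℚ :- (con 1ℚ :- r)) refl ((1ℚ - p) ^ℚ l)) ⟩
    q * φ true + (1ℚ - q) * φ false
      ≡⟨ cong₂ _+_ (sumSets-*-assoc {n} q (weight q) (h ∘ (true ∷_)))
                   (sumSets-*-assoc {n} (1ℚ - q) (weight q) (h ∘ (false ∷_))) ⟨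
    sumSets {suc n} (λ Y → weight q Y * h Y) ∎
    where
    open ≡-Reasoning
    φ : Bool → ℚ
    φ b = sumSets {n} λ Y → weight q Y * h (b ∷ Y)
    fibre : ∀ x → sumSets {n *ℕ l} (λ y → weight p (x ++ y) * h (shadow l (x ++ y))) ≡
                  weight p x * φ (nonempty x)
    fibre x = begin
      sumSets {n *ℕ l} (λ y → weight p (x ++ y) * h (shadow l (x ++ y)))
        ≡⟨ sumSets-cong {n *ℕ l} (λ y → cong₂ _*_ (weight-++ p x y) (cong h (shadow-++ l x y))) ⟩
      sumSets {n *ℕ l} (λ y → (weight p x * weight p y) * h (nonempty x ∷ shadow l y))
        ≡⟨ sumSets-*-assoc {n *ℕ l} (weight p x) (weight p) (h ∘ (nonempty x ∷_) ∘ shadow l) ⟩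
      weight p x * sumSets {n *ℕ l} (λ y → weight p y * h (nonempty x ∷ shadow l y))
        ≡⟨ cong (weight p x *_) (sumSets-shadow n (h ∘ (nonempty x ∷_))) ⟩
      weight p x * φ (nonempty x) ∎

indicator : Bool → ℚ
indicator b = if b then 1ℚ else 0ℚ

nodeRel-sumSets : ∀ {n} (A : Adjacency n) p →
  nodeRel A p ≡ sumSets (λ S → weight p S * indicator (isConnectedSet A S))
nodeRel-sumSets {n} A p =
  trans (sumℚ-allSets {n} _) (sumSets-cong {n} λ S → if-else-0 (isConnectedSet A S) (weight p S))
  where
  if-else-0 : ∀ b w → (if b then w else 0ℚ) ≡ w * indicator b
  if-else-0 true  w = sym (*-identityʳ w)
  if-else-0 false w = sym (*-zeroʳ w)

-- The identity is polynomial in p and also holds for l = 0.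
mainTheorem1 : (n : ℕ) (G : SimpleGraph n) (l : ℕ) → l ≥ 1 →
    (p : ℚ) → 0ℚ ≤ p → p ≤ 1ℚ →
    nodeRel (lexK G l) p ≡ nodeRel (adj G) (1ℚ - (1ℚ - p) ^ℚ l)
mainTheorem1 n G l _ p _ _ = begin
  nodeRel (lexK G l) p
    ≡⟨ nodeRel-sumSets (lexK G l) p ⟩
  sumSets (λ X → weight p X * indicator (isConnectedSet (lexK G l) X))
    ≡⟨ sumSets-cong {n *ℕ l} (λ X → cong (weight p X *_) (cong indicator (isConnectedSet-lexK G l X))) ⟩
  sumSets (λ X → weight p X * indicator (isConnectedSet (adj G) (shadow l X)))
    ≡⟨ sumSets-shadow l p n (indicator ∘ isConnectedSet (adj G)) ⟩
  sumSets (λ Y → weight q Y * indicator (isConnectedSet (adj G) Y))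
    ≡⟨ nodeRel-sumSets (adj G) q ⟨
  nodeRel (adj G) q ∎
  where
  open ≡-Reasoning
  q = 1ℚ - (1ℚ - p) ^ℚ l
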